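{- Let $\Gamma$ be a $(d-1)$-dimensional strongly edge decomposable complex on $[n]$. Then $\dim\mathcal C_\Gamma(i,j)=d-1$ and $\dim\mathrm{lk}_\Gamma(\{i,j\})=d-3$ for any $\{i,j\}\in\Gamma$ (with $i<j$).
   Context: A simplicial complex on $[n]$: subsets of $[n]$ containing all singletons, closed under subsets; $\dim\Gamma=\max\{|F|-1:F\in\Gamma\}$; pure means all facets (maximal faces) have the same size. $\mathrm{lk}_\Gamma(F)=\{G\subset[n]\setminus F:G\cup F\in\Gamma\}$, $\mathrm{lk}_\Gamma(v)=\mathrm{lk}_\Gamma(\{v\})$. For $i<j$, $\mathcal C_\Gamma(i,j)=\{F\in\Gamma:i\notin F\}\cup\{(F\setminus\{i\})\cup\{j\}:i\in F\in\Gamma\}$. Link condition w.r.t. $\{i,j\}$: $\mathrm{lk}_\Gamma(i)\cap\mathrm{lk}_\Gamma(j)=\mathrm{lk}_\Gamma(\{i,j\})$. Strongly edge decomposable (recursive): boundary complexes of simplices and $\{\emptyset\}$ are strongly edge decomposable; a pure complex $\Gamma$ is strongly edge decomposable if there exists $\{i,j\}\in\Gamma$ such that $\Gamma$ satisfies the Link condition w.r.t. $\{i,j\}$ and both $\mathcal C_\Gamma(i,j)$ and $\mathrm{lk}_\Gamma(\{i,j\})$ are strongly edge decomposable. -}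

module Defs where

open import Data.Nat using (ℕ)
open import Data.Integer using (ℤ; +_; _+_; _≤_)
open import Data.Fin using (Fin; _<_)
open import Data.Fin.Subset using (Subset; _∈_; _∉_; _⊆_; _⊂_; _∪_; _∩_; _-_; ⁅_⁆; ∣_∣; Nonempty; ⊥)
open import Data.Product using (Σ; ∃; ∃-syntax; _×_)
open import Data.Sum using (_⊎_)
open import Relation.Binary.PropositionalEquality using (_≡_)
open import Function.Bundles using (_⇔_)

-- A family of subsets of the vertex set [n] (modelled as Fin n).
Family : ℕ → Set₁
Family n = Subset n → Set

module _ {n : ℕ} where

  IsSimplicialComplexOn : Family n → Set
  IsSimplicialComplexOn Γ =
    (∀ (v : Fin n) → Γ ⁅ v ⁆) × (∀ (F G : Subset n) → Γ G → F ⊆ G → Γ F)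

  HasDim : Family n → ℤ → Set
  HasDim Γ k =
    (∃[ F ] (Γ F × + ∣ F ∣ ≡ k + + 1)) × (∀ F → Γ F → + ∣ F ∣ ≤ k + + 1)

  IsFacet : Family n → Subset n → Set
  IsFacet Γ F = Γ F × (∀ G → Γ G → F ⊆ G → G ≡ F)

  Pure : Family n → Set
  Pure Γ = ∀ F G → IsFacet Γ F → IsFacet Γ G → ∣ F ∣ ≡ ∣ G ∣

  lk : Family n → Subset n → Family n
  lk Γ F G = (G ∩ F ≡ ⊥) × Γ (G ∪ F)

  edge : Fin n → Fin n → Subset n
  edge i j = ⁅ i ⁆ ∪ ⁅ j ⁆

  C : Family n → Fin n → Fin n → Family n
  C Γ i j F = (i ∉ F × Γ F) ⊎ (∃[ G ] (Γ G × i ∈ G × F ≡ (G - i) ∪ ⁅ j ⁆))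

  LinkCondition : Family n → Fin n → Fin n → Set
  LinkCondition Γ i j = ∀ G → (lk Γ ⁅ i ⁆ G × lk Γ ⁅ j ⁆ G) ⇔ lk Γ (edge i j) G

  IsSimplexBoundary : Family n → Set
  IsSimplexBoundary Γ = ∃[ V ] (Nonempty V × (∀ F → Γ F ⇔ F ⊂ V))

  IsEmptyComplex : Family n → Set
  IsEmptyComplex Γ = ∀ F → Γ F ⇔ (F ≡ ⊥)

  data StronglyEdgeDecomposable : Family n → Set₁ where
    sed-boundary : ∀ {Γ} → IsSimplexBoundary Γ → StronglyEdgeDecomposable Γ
    sed-empty    : ∀ {Γ} → IsEmptyComplex Γ → StronglyEdgeDecomposable Γ
    sed-step     : ∀ {Γ} (i j : Fin n) → Pure Γ → i < j → Γ (edge i j) →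
                   LinkCondition Γ i j →
                   StronglyEdgeDecomposable (C Γ i j) →
                   StronglyEdgeDecomposable (lk Γ (edge i j)) →
                   StronglyEdgeDecomposable Γ

-- Strongly edge decomposable complexes satisfy a stronger invariant than purity: for some s,
-- every face extends to a face of size s, no face is larger, and every vertex is missed by
-- some face of size s.  The invariant passes through an edge decomposition at {a,b}: a face
-- of the contraction missing b is a facet of Γ of size s_C, a facet of the link joined with
-- {a,b} is a facet of size s_L + 2, so purity forces s_C = s_L + 2, and faces are extended
-- inside the contraction or, via the link condition, inside the link.  For any edge {i,j}
-- the invariant then gives the dimensions of C_Γ(i,j) and lk_Γ({i,j}) directly: a face of
-- size s missing i lies in the contraction, and a face of size s through {i,j} yields a
-- link face of size s - 2.
module Submission where

open import Defs

open import Data.Nat using (ℕ; suc; _+_; _≤_; s≤s)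
open import Data.Nat.Properties
  using (+-suc; +-comm; ≤-antisym; ≤-trans; ≤-reflexive; ≤-pred; <⇒≱; +-monoˡ-≤; +-cancelʳ-≤;
         suc-injective; n≤1+n; module ≤-Reasoning)
open import Data.Fin using (Fin; _<_; _≟_)
open import Data.Fin.Properties using (<⇒≢)
open import Data.Fin.Subset hiding (_-_)
open import Data.Fin.Subset using () renaming (_-_ to _∖_)
open import Data.Fin.Subset.Properties
open import Data.Vec using ([]; _∷_; here; there)
open import Data.Vec.Properties using (∷-injectiveʳ)
open import Data.Product using (∃-syntax; _×_; _,_; proj₁; proj₂)
open import Data.Sum using (_⊎_; inj₁; inj₂; [_,_]′)
open import Data.Empty using (⊥-elim)
open import Function using (_∘_)
open import Function.Bundles using (Equivalence)
open import Relation.Nullary using (yes; no)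
open import Relation.Binary.PropositionalEquality

open Equivalence using (to; from)

x∈p─q⇒x∉q : ∀ {n} (p q : Subset n) {x} → x ∈ p ─ q → x ∉ q
x∈p─q⇒x∉q (_ ∷ p) (outside ∷ q) here ()
x∈p─q⇒x∉q (_ ∷ p) (_ ∷ q) (there x∈p─q) (there x∈q) = x∈p─q⇒x∉q p q x∈p─q x∈q

module _ {n : ℕ} where

  ⁅x⁆⊆p : ∀ {p : Subset n} {x} → x ∈ p → ⁅ x ⁆ ⊆ p
  ⁅x⁆⊆p {p} {x} x∈p y∈⁅x⁆ = subst (_∈ p) (sym (x∈⁅y⁆⇒x≡y x y∈⁅x⁆)) x∈p

  x∈p∖y⁻ : ∀ {p : Subset n} {x y} → x ∈ p ∖ y → x ∈ p × x ≢ y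
  x∈p∖y⁻ {p} {x} {y} x∈p∖y =
    p─q⊆p p ⁅ y ⁆ x∈p∖y , λ { refl → x∈p─q⇒x∉q p ⁅ y ⁆ x∈p∖y (x∈⁅x⁆ y) }

  x∈p∪⁅y⁆⁻ : ∀ {p : Subset n} {x y} → x ∈ p ∪ ⁅ y ⁆ → x ∈ p ⊎ x ≡ y
  x∈p∪⁅y⁆⁻ {p} {y = y} x∈ with x∈p∪q⁻ p ⁅ y ⁆ x∈
  ... | inj₁ x∈p   = inj₁ x∈p
  ... | inj₂ x∈⁅y⁆ = inj₂ (x∈⁅y⁆⇒x≡y y x∈⁅y⁆)

  p⊆p─q∪q : ∀ (p q : Subset n) → p ⊆ (p ─ q) ∪ q
  p⊆p─q∪q p q {x} x∈p with x ∈? q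
  ... | yes x∈q = q⊆p∪q (p ─ q) q x∈q
  ... | no  x∉q = p⊆p∪q q (x∈p∧x∉q⇒x∈p─q x∈p x∉q)

  p∩q≡⊥ : ∀ {p q : Subset n} → (∀ {x} → x ∈ p → x ∉ q) → p ∩ q ≡ ⊥
  p∩q≡⊥ {p} {q} disjoint = Empty-unique λ (x , x∈p∩q) →
    let x∈p , x∈q = x∈p∩q⁻ p q x∈p∩q in disjoint x∈p x∈q

  p∩q≡⊥⇒x∉q : ∀ {p q : Subset n} {x} → p ∩ q ≡ ⊥ → x ∈ p → x ∉ q
  p∩q≡⊥⇒x∉q p∩q≡⊥ x∈p x∈q = ∉⊥ (subst (_ ∈_) p∩q≡⊥ (x∈p∩q⁺ (x∈p , x∈q)))

  p─q∩r≡⊥ : ∀ (p : Subset n) {q r} → r ⊆ q → (p ─ q) ∩ r ≡ ⊥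
  p─q∩r≡⊥ p {q} r⊆q = p∩q≡⊥ λ x∈p─q x∈r → x∈p─q⇒x∉q p q x∈p─q (r⊆q x∈r)

  p⊆q⇒∣q∣≤∣p∣⇒p≡q : ∀ {p q : Subset n} → p ⊆ q → ∣ q ∣ ≤ ∣ p ∣ → p ≡ q
  p⊆q⇒∣q∣≤∣p∣⇒p≡q {p} {q} p⊆q ∣q∣≤∣p∣ = ⊆-antisym p⊆q q⊆p
    where
    q⊆p : q ⊆ p
    q⊆p {x} x∈q with x ∈? p
    ... | yes x∈p = x∈p
    ... | no  x∉p = ⊥-elim (<⇒≱ (p⊂q⇒∣p∣<∣q∣ (p⊆q , x , x∈q , x∉p)) ∣q∣≤∣p∣)

∣p∪q∣≡∣p∣+∣q∣ : ∀ {n} (p q : Subset n) → p ∩ q ≡ ⊥ → ∣ p ∪ q ∣ ≡ ∣ p ∣ + ∣ q ∣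
∣p∪q∣≡∣p∣+∣q∣ []            []            _  = refl
∣p∪q∣≡∣p∣+∣q∣ (inside  ∷ p) (inside  ∷ q) ()
∣p∪q∣≡∣p∣+∣q∣ (inside  ∷ p) (outside ∷ q) eq = cong suc (∣p∪q∣≡∣p∣+∣q∣ p q (∷-injectiveʳ eq))
∣p∪q∣≡∣p∣+∣q∣ (outside ∷ p) (inside  ∷ q) eq =
  trans (cong suc (∣p∪q∣≡∣p∣+∣q∣ p q (∷-injectiveʳ eq))) (sym (+-suc ∣ p ∣ ∣ q ∣))
∣p∪q∣≡∣p∣+∣q∣ (outside ∷ p) (outside ∷ q) eq = ∣p∪q∣≡∣p∣+∣q∣ p q (∷-injectiveʳ eq)

∣p─q∣+∣q∣≡∣p∣ : ∀ {n} (p q : Subset n) → q ⊆ p → ∣ p ─ q ∣ + ∣ q ∣ ≡ ∣ p ∣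
∣p─q∣+∣q∣≡∣p∣ []            []            _   = refl
∣p─q∣+∣q∣≡∣p∣ (inside  ∷ p) (inside  ∷ q) q⊆p =
  trans (+-suc ∣ p ─ q ∣ ∣ q ∣) (cong suc (∣p─q∣+∣q∣≡∣p∣ p q (drop-∷-⊆ q⊆p)))
∣p─q∣+∣q∣≡∣p∣ (outside ∷ p) (inside  ∷ q) q⊆p with q⊆p here
... | ()
∣p─q∣+∣q∣≡∣p∣ (inside  ∷ p) (outside ∷ q) q⊆p = cong suc (∣p─q∣+∣q∣≡∣p∣ p q (drop-∷-⊆ q⊆p))
∣p─q∣+∣q∣≡∣p∣ (outside ∷ p) (outside ∷ q) q⊆p = ∣p─q∣+∣q∣≡∣p∣ p q (drop-∷-⊆ q⊆p)

module _ {n : ℕ} where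

  suc∣p∖x∣≡∣p∣ : ∀ {p : Subset n} {x} → x ∈ p → suc ∣ p ∖ x ∣ ≡ ∣ p ∣
  suc∣p∖x∣≡∣p∣ {p} {x} x∈p = begin
    suc ∣ p ∖ x ∣          ≡⟨ +-comm 1 ∣ p ∖ x ∣ ⟩
    ∣ p ∖ x ∣ + 1          ≡⟨ cong (_+_ ∣ p ∖ x ∣) (sym (∣⁅x⁆∣≡1 x)) ⟩
    ∣ p ∖ x ∣ + ∣ ⁅ x ⁆ ∣  ≡⟨ ∣p─q∣+∣q∣≡∣p∣ p ⁅ x ⁆ (⁅x⁆⊆p x∈p) ⟩
    ∣ p ∣                  ∎
    where open ≡-Reasoning

  ∣p∪⁅x⁆∣≡suc∣p∣ : ∀ {p : Subset n} {x} → x ∉ p → ∣ p ∪ ⁅ x ⁆ ∣ ≡ suc ∣ p ∣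
  ∣p∪⁅x⁆∣≡suc∣p∣ {p} {x} x∉p = begin
    ∣ p ∪ ⁅ x ⁆ ∣      ≡⟨ ∣p∪q∣≡∣p∣+∣q∣ p ⁅ x ⁆ p∩⁅x⁆≡⊥ ⟩
    ∣ p ∣ + ∣ ⁅ x ⁆ ∣  ≡⟨ cong (_+_ ∣ p ∣) (∣⁅x⁆∣≡1 x) ⟩
    ∣ p ∣ + 1          ≡⟨ +-comm ∣ p ∣ 1 ⟩
    suc ∣ p ∣          ∎
    where
    open ≡-Reasoning
    p∩⁅x⁆≡⊥ : p ∩ ⁅ x ⁆ ≡ ⊥
    p∩⁅x⁆≡⊥ = p∩q≡⊥ λ y∈p y∈⁅x⁆ → x∉p (subst (_∈ p) (x∈⁅y⁆⇒x≡y x y∈⁅x⁆) y∈p)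

  a∈edge : ∀ {a b : Fin n} → a ∈ edge a b
  a∈edge {a} {b} = p⊆p∪q ⁅ b ⁆ (x∈⁅x⁆ a)

  b∈edge : ∀ {a b : Fin n} → b ∈ edge a b
  b∈edge {a} {b} = q⊆p∪q ⁅ a ⁆ ⁅ b ⁆ (x∈⁅x⁆ b)

  edge⊆ : ∀ {a b : Fin n} {F} → a ∈ F → b ∈ F → edge a b ⊆ F
  edge⊆ a∈F b∈F x∈edge with x∈p∪⁅y⁆⁻ x∈edge
  ... | inj₁ x∈⁅a⁆ = ⁅x⁆⊆p a∈F x∈⁅a⁆
  ... | inj₂ refl  = b∈F

  ∣edge∣≡2 : ∀ {a b : Fin n} → a ≢ b → ∣ edge a b ∣ ≡ 2
  ∣edge∣≡2 {a} {b} a≢b =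
    trans (∣p∪⁅x⁆∣≡suc∣p∣ λ b∈⁅a⁆ → a≢b (sym (x∈⁅y⁆⇒x≡y a b∈⁅a⁆))) (cong suc (∣⁅x⁆∣≡1 a))

  DownClosed : Family n → Set
  DownClosed Γ = ∀ F G → Γ G → F ⊆ G → Γ F

  record PureOfSize (Γ : Family n) (s : ℕ) : Set where
    field
      size≤  : ∀ {F} → Γ F → ∣ F ∣ ≤ s
      extend : ∀ {F} → Γ F → ∃[ H ] (Γ H × F ⊆ H × ∣ H ∣ ≡ s)

  NoConeVertex : Family n → ℕ → Set
  NoConeVertex Γ s = ∀ v → ∃[ H ] (Γ H × v ∉ H × ∣ H ∣ ≡ s)

  -- `HasDim Γ (s - 1)` with faces measured by their size in ℕ.
  HasSize : Family n → ℕ → Set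
  HasSize Γ s = (∃[ F ] (Γ F × ∣ F ∣ ≡ s)) × (∀ {F} → Γ F → ∣ F ∣ ≤ s)

  open PureOfSize

  maximal⇒facet : ∀ {Γ : Family n} {H} → Γ H → (∀ {G} → Γ G → H ⊆ G → ∣ G ∣ ≤ ∣ H ∣) →
                  IsFacet Γ H
  maximal⇒facet ΓH maximal = ΓH , λ G ΓG H⊆G → sym (p⊆q⇒∣q∣≤∣p∣⇒p≡q H⊆G (maximal ΓG H⊆G))

  pure⇒hasSize : ∀ {Γ : Family n} {s F} → PureOfSize Γ s → Γ F → HasSize Γ s
  pure⇒hasSize pure ΓF with H , ΓH , _ , ∣H∣ ← extend pure ΓF = (H , ΓH , ∣H∣) , size≤ pure

  lk-closed : ∀ {Γ : Family n} {E} → DownClosed Γ → DownClosed (lk Γ E)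
  lk-closed {E = E} closed F G (G∩E≡⊥ , ΓG∪E) F⊆G =
      p∩q≡⊥ (p∩q≡⊥⇒x∉q G∩E≡⊥ ∘ F⊆G)
    , closed _ _ ΓG∪E λ x∈F∪E → [ p⊆p∪q E ∘ F⊆G , q⊆p∪q _ E ]′ (x∈p∪q⁻ F E x∈F∪E)

  lk-split : ∀ {Γ : Family n} {E G} → DownClosed Γ → Γ G → E ⊆ G → lk Γ E (G ─ E)
  lk-split {E = E} {G} closed ΓG E⊆G =
      p─q∩r≡⊥ G (λ x∈E → x∈E)
    , closed _ G ΓG λ x∈ → [ p─q⊆p G E , E⊆G ]′ (x∈p∪q⁻ (G ─ E) E x∈)

  link-hasSize : ∀ {Γ : Family n} {s E} → DownClosed Γ → PureOfSize Γ s → Γ E →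
                 ∃[ m ] (m + ∣ E ∣ ≡ s × HasSize (lk Γ E) m)
  link-hasSize {Γ} {s} {E} closed pure ΓE with H , ΓH , E⊆H , ∣H∣ ← extend pure ΓE =
    ∣ H ─ E ∣ , m+∣E∣≡s , (H ─ E , lk-split closed ΓH E⊆H , refl) , bound
    where
    m+∣E∣≡s : ∣ H ─ E ∣ + ∣ E ∣ ≡ s
    m+∣E∣≡s = trans (∣p─q∣+∣q∣≡∣p∣ H E E⊆H) ∣H∣
    bound : ∀ {K} → lk Γ E K → ∣ K ∣ ≤ ∣ H ─ E ∣
    bound {K} lkK = +-cancelʳ-≤ (∣ E ∣) (∣ K ∣) (∣ H ─ E ∣)
      (subst₂ _≤_ (∣p∪q∣≡∣p∣+∣q∣ K E (proj₁ lkK)) (sym m+∣E∣≡s) (size≤ pure (proj₂ lkK)))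

  simplexBoundary-pureNoCone : ∀ {Γ : Family n} → IsSimplexBoundary Γ →
                  ∃[ s ] (PureOfSize Γ s × NoConeVertex Γ s)
  simplexBoundary-pureNoCone {Γ} (V , (x₀ , x₀∈V) , Γ⇔⊂V) =
    ∣ V ∖ x₀ ∣ , record { size≤ = bound ; extend = extend′ } , avoid
    where
    facet : ∀ {y} → y ∈ V → Γ (V ∖ y) × y ∉ V ∖ y × ∣ V ∖ y ∣ ≡ ∣ V ∖ x₀ ∣
    facet {y} y∈V =
        from (Γ⇔⊂V _) (p─q⊆p V ⁅ y ⁆ , y , y∈V , y∉V∖y)
      , y∉V∖y
      , suc-injective (trans (suc∣p∖x∣≡∣p∣ y∈V) (sym (suc∣p∖x∣≡∣p∣ x₀∈V)))
      where
      y∉V∖y : y ∉ V ∖ y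
      y∉V∖y y∈V∖y = proj₂ (x∈p∖y⁻ y∈V∖y) refl
    bound : ∀ {F} → Γ F → ∣ F ∣ ≤ ∣ V ∖ x₀ ∣
    bound {F} ΓF = ≤-pred (subst (suc ∣ F ∣ ≤_) (sym (suc∣p∖x∣≡∣p∣ x₀∈V))
                                 (p⊂q⇒∣p∣<∣q∣ (to (Γ⇔⊂V F) ΓF)))
    extend′ : ∀ {F} → Γ F → ∃[ H ] (Γ H × F ⊆ H × ∣ H ∣ ≡ ∣ V ∖ x₀ ∣)
    extend′ {F} ΓF with F⊆V , y , y∈V , y∉F ← to (Γ⇔⊂V F) ΓF =
      let ΓV∖y , _ , ∣V∖y∣ = facet y∈V in
      V ∖ y , ΓV∖y , (λ x∈F → x∈p∧x≢y⇒x∈p-y (F⊆V x∈F) λ { refl → y∉F x∈F }) , ∣V∖y∣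
    avoid : NoConeVertex Γ ∣ V ∖ x₀ ∣
    avoid v with v ∈? V
    ... | yes v∈V = V ∖ v , facet v∈V
    ... | no  v∉V = V ∖ x₀ , proj₁ (facet x₀∈V) , v∉V ∘ p─q⊆p V ⁅ x₀ ⁆ , refl

  emptyComplex-pureNoCone : ∀ {Γ : Family n} → IsEmptyComplex Γ → PureOfSize Γ 0 × NoConeVertex Γ 0
  emptyComplex-pureNoCone {Γ} Γ⇔≡⊥ =
      record { size≤ = λ ΓF → ≤-reflexive (∣F∣≡0 ΓF)
             ; extend = λ {F} ΓF → ⊥ , Γ⊥ , subst (F ⊆_) (to (Γ⇔≡⊥ F) ΓF) (λ x∈F → x∈F) , ∣⊥∣≡0 n }
    , λ _ → ⊥ , Γ⊥ , ∉⊥ , ∣⊥∣≡0 n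
    where
    Γ⊥ : Γ ⊥
    Γ⊥ = from (Γ⇔≡⊥ ⊥) refl
    ∣F∣≡0 : ∀ {F} → Γ F → ∣ F ∣ ≡ 0
    ∣F∣≡0 {F} ΓF = trans (cong ∣_∣ (to (Γ⇔≡⊥ F) ΓF)) (∣⊥∣≡0 n)

module Contraction {n : ℕ} (a b : Fin n) where

  open PureOfSize

  img : Subset n → Subset n
  img G = (G ∖ a) ∪ ⁅ b ⁆

  b∈img : ∀ G → b ∈ img G
  b∈img G = q⊆p∪q (G ∖ a) ⁅ b ⁆ (x∈⁅x⁆ b)

  ∈-img⁺ : ∀ {G x} → x ∈ G → x ≢ a → x ∈ img G
  ∈-img⁺ x∈G x≢a = p⊆p∪q ⁅ b ⁆ (x∈p∧x≢y⇒x∈p-y x∈G x≢a)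

  ∈-img⁻ : ∀ {G x} → x ∈ img G → x ≢ b → x ∈ G
  ∈-img⁻ x∈imgG x≢b with x∈p∪⁅y⁆⁻ x∈imgG
  ... | inj₁ x∈G∖a = proj₁ (x∈p∖y⁻ x∈G∖a)
  ... | inj₂ x≡b   = ⊥-elim (x≢b x≡b)

  ∣img∣≡ : ∀ {G} → a ∈ G → b ∉ G → ∣ img G ∣ ≡ ∣ G ∣
  ∣img∣≡ a∈G b∉G = trans (∣p∪⁅x⁆∣≡suc∣p∣ (b∉G ∘ proj₁ ∘ x∈p∖y⁻)) (suc∣p∖x∣≡∣p∣ a∈G)

  ⊆-from-img : ∀ {F G} → a ∈ G → b ∉ F → (∀ {x} → x ∈ F → x ≢ a → x ∈ img G) → F ⊆ G
  ⊆-from-img a∈G b∉F F⊆imgG {x} x∈F with x ≟ a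
  ... | yes refl = a∈G
  ... | no  x≢a  = ∈-img⁻ (F⊆imgG x∈F x≢a) λ { refl → b∉F x∈F }

  module _ (a≢b : a ≢ b) where

    a∉img : ∀ G → a ∉ img G
    a∉img G a∈imgG with x∈p∪⁅y⁆⁻ a∈imgG
    ... | inj₁ a∈G∖a = proj₂ (x∈p∖y⁻ a∈G∖a) refl
    ... | inj₂ a≡b   = a≢b a≡b

    ∣img∣< : ∀ {G} → a ∈ G → b ∈ G → suc ∣ img G ∣ ≤ ∣ G ∣
    ∣img∣< {G} a∈G b∈G = ≤-trans (s≤s (p⊆q⇒∣p∣≤∣q∣ imgG⊆G∖a)) (≤-reflexive (suc∣p∖x∣≡∣p∣ a∈G))
      where
      imgG⊆G∖a : img G ⊆ G ∖ a
      imgG⊆G∖a x∈imgG with x∈p∪⁅y⁆⁻ x∈imgG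
      ... | inj₁ x∈G∖a = x∈G∖a
      ... | inj₂ refl  = x∈p∧x≢y⇒x∈p-y b∈G (a≢b ∘ sym)

    ∣img∣≤ : ∀ {G} → a ∈ G → ∣ img G ∣ ≤ ∣ G ∣
    ∣img∣≤ {G} a∈G with b ∈? G
    ... | yes b∈G = ≤-trans (n≤1+n _) (∣img∣< a∈G b∈G)
    ... | no  b∉G = ≤-reflexive (∣img∣≡ a∈G b∉G)

    img-section : ∀ {F} → a ∉ F → b ∈ F → img ((F ∖ b) ∪ ⁅ a ⁆) ≡ F
    img-section {F} a∉F b∈F = ⊆-antisym ⊆F F⊆
      where
      ⊆F : img ((F ∖ b) ∪ ⁅ a ⁆) ⊆ F
      ⊆F x∈ with x∈p∪⁅y⁆⁻ x∈
      ... | inj₂ refl = b∈F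
      ... | inj₁ x∈F′∖a with x∈p∖y⁻ x∈F′∖a
      ...   | x∈F′ , x≢a with x∈p∪⁅y⁆⁻ x∈F′
      ...     | inj₁ x∈F∖b = proj₁ (x∈p∖y⁻ x∈F∖b)
      ...     | inj₂ x≡a   = ⊥-elim (x≢a x≡a)
      F⊆ : F ⊆ img ((F ∖ b) ∪ ⁅ a ⁆)
      F⊆ {x} x∈F with x ≟ b
      ... | yes refl = b∈img _
      ... | no  x≢b  =
        ∈-img⁺ (p⊆p∪q ⁅ a ⁆ (x∈p∧x≢y⇒x∈p-y x∈F x≢b)) λ { refl → a∉F x∈F }

    C-closed : ∀ {Γ} → DownClosed Γ → DownClosed (C Γ a b)
    C-closed closed F H (inj₁ (a∉H , ΓH)) F⊆H = inj₁ (a∉H ∘ F⊆H , closed F H ΓH F⊆H)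
    C-closed closed F _ (inj₂ (G , ΓG , a∈G , refl)) F⊆imgG with b ∈? F
    ... | no b∉F =
      inj₁ (a∉img G ∘ F⊆imgG , closed F G ΓG (⊆-from-img a∈G b∉F λ x∈F _ → F⊆imgG x∈F))
    ... | yes b∈F = inj₂ (F′ , closed F′ G ΓG F′⊆G , q⊆p∪q (F ∖ b) ⁅ a ⁆ (x∈⁅x⁆ a) ,
                          sym (img-section (a∉img G ∘ F⊆imgG) b∈F))
      where
      F′ : Subset n
      F′ = (F ∖ b) ∪ ⁅ a ⁆
      F′⊆G : F′ ⊆ G
      F′⊆G x∈F′ with x∈p∪⁅y⁆⁻ x∈F′
      ... | inj₁ x∈F∖b = let x∈F , x≢b = x∈p∖y⁻ x∈F∖b in ∈-img⁻ (F⊆imgG x∈F) x≢b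
      ... | inj₂ refl  = a∈G

    contraction-hasSize : ∀ {Γ s} → PureOfSize Γ s → NoConeVertex Γ s → HasSize (C Γ a b) s
    contraction-hasSize {Γ} {s} pure noCone
      with H , ΓH , a∉H , ∣H∣ ← noCone a = (H , inj₁ (a∉H , ΓH) , ∣H∣) , bound
      where
      bound : ∀ {F} → C Γ a b F → ∣ F ∣ ≤ s
      bound (inj₁ (_ , ΓF)) = size≤ pure ΓF
      bound (inj₂ (G , ΓG , a∈G , refl)) = ≤-trans (∣img∣≤ a∈G) (size≤ pure ΓG)

module EdgeStep {n : ℕ} {Γ : Family n} {a b : Fin n} {sC sL : ℕ}
  (a≢b : a ≢ b) (closed : DownClosed Γ) (pure : Pure Γ) (link : LinkCondition Γ a b)
  (C-pure : PureOfSize (C Γ a b) sC) (C-noCone : NoConeVertex (C Γ a b) sC)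
  (L-pure : PureOfSize (lk Γ (edge a b)) sL) (L-noCone : NoConeVertex (lk Γ (edge a b)) sL)
  where

  open Contraction a b
  open PureOfSize

  e : Subset n
  e = edge a b

  face-missing-edge : ∃[ H ] (Γ H × a ∉ H × b ∉ H × ∣ H ∣ ≡ sC)
  face-missing-edge with C-noCone b
  ... | H , inj₁ (a∉H , ΓH) , b∉H , ∣H∣ = H , ΓH , a∉H , b∉H , ∣H∣
  ... | _ , inj₂ (G , _ , _ , refl) , b∉imgG , _ = ⊥-elim (b∉imgG (b∈img G))

  edge-face-size≤ : ∀ {G} → Γ G → e ⊆ G → ∣ G ∣ ≤ sL + 2
  edge-face-size≤ {G} ΓG e⊆G = begin
    ∣ G ∣              ≡⟨ sym (∣p─q∣+∣q∣≡∣p∣ G e e⊆G) ⟩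
    ∣ G ─ e ∣ + ∣ e ∣  ≡⟨ cong (_+_ ∣ G ─ e ∣) (∣edge∣≡2 a≢b) ⟩
    ∣ G ─ e ∣ + 2      ≤⟨ +-monoˡ-≤ 2 (size≤ L-pure (lk-split closed ΓG e⊆G)) ⟩
    sL + 2             ∎
    where open ≤-Reasoning

  ∣M∪e∣≡sL+2 : ∀ {M} → lk Γ e M → ∣ M ∣ ≡ sL → ∣ M ∪ e ∣ ≡ sL + 2
  ∣M∪e∣≡sL+2 {M} lkM ∣M∣ = trans (∣p∪q∣≡∣p∣+∣q∣ M e (proj₁ lkM)) (cong₂ _+_ ∣M∣ (∣edge∣≡2 a≢b))

  -- A larger face through H would contain a, and its image in the contraction would
  -- contain H ∪ {b}, which is too large.
  facet-missing-edge : ∀ {H} → Γ H → a ∉ H → b ∉ H → ∣ H ∣ ≡ sC → IsFacet Γ H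
  facet-missing-edge {H} ΓH a∉H b∉H ∣H∣ = maximal⇒facet ΓH maximal
    where
    maximal : ∀ {G} → Γ G → H ⊆ G → ∣ G ∣ ≤ ∣ H ∣
    maximal {G} ΓG H⊆G with a ∈? G
    ... | no a∉G = subst (∣ G ∣ ≤_) (sym ∣H∣) (size≤ C-pure (inj₁ (a∉G , ΓG)))
    ... | yes a∈G = ⊥-elim (<⇒≱ sC<∣imgG∣ (size≤ C-pure (inj₂ (G , ΓG , a∈G , refl))))
      where
      H∪b⊆imgG : H ∪ ⁅ b ⁆ ⊆ img G
      H∪b⊆imgG x∈ with x∈p∪⁅y⁆⁻ x∈
      ... | inj₁ x∈H = ∈-img⁺ (H⊆G x∈H) λ { refl → a∉H x∈H }
      ... | inj₂ refl = b∈img G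
      sC<∣imgG∣ : suc sC ≤ ∣ img G ∣
      sC<∣imgG∣ = subst (_≤ ∣ img G ∣) (trans (∣p∪⁅x⁆∣≡suc∣p∣ b∉H) (cong suc ∣H∣))
                        (p⊆q⇒∣p∣≤∣q∣ H∪b⊆imgG)

  facet-through-link : ∀ {M} → lk Γ e M → ∣ M ∣ ≡ sL → IsFacet Γ (M ∪ e)
  facet-through-link {M} lkM ∣M∣ = maximal⇒facet (proj₂ lkM) λ ΓG M∪e⊆G →
    ≤-trans (edge-face-size≤ ΓG (M∪e⊆G ∘ q⊆p∪q M e)) (≤-reflexive (sym (∣M∪e∣≡sL+2 lkM ∣M∣)))

  sC≡sL+2 : sC ≡ sL + 2
  sC≡sL+2 with H , ΓH , a∉H , b∉H , ∣H∣ ← face-missing-edge | M , lkM , _ , ∣M∣ ← L-noCone a =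
    begin
      sC         ≡⟨ sym ∣H∣ ⟩
      ∣ H ∣      ≡⟨ pure H (M ∪ e) (facet-missing-edge ΓH a∉H b∉H ∣H∣) (facet-through-link lkM ∣M∣) ⟩
      ∣ M ∪ e ∣  ≡⟨ ∣M∪e∣≡sL+2 lkM ∣M∣ ⟩
      sL + 2     ∎
    where open ≡-Reasoning

  Γ-size≤ : ∀ {F} → Γ F → ∣ F ∣ ≤ sC
  Γ-size≤ {F} ΓF with a ∈? F | b ∈? F
  ... | no  a∉F | _       = size≤ C-pure (inj₁ (a∉F , ΓF))
  ... | yes a∈F | no  b∉F =
    subst (_≤ sC) (∣img∣≡ a∈F b∉F) (size≤ C-pure (inj₂ (F , ΓF , a∈F , refl)))
  ... | yes a∈F | yes b∈F = subst (∣ F ∣ ≤_) (sym sC≡sL+2) (edge-face-size≤ ΓF (edge⊆ a∈F b∈F))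

  img-face : ∀ {G} → Γ G → a ∈ G → ∣ img G ∣ ≡ sC → ∣ G ∣ ≡ sC
  img-face {G} ΓG a∈G ∣imgG∣ = trans (sym (∣img∣≡ a∈G b∉G)) ∣imgG∣
    where
    b∉G : b ∉ G
    b∉G b∈G = <⇒≱ (∣img∣< a≢b a∈G b∈G) (subst (∣ G ∣ ≤_) (sym ∣imgG∣) (Γ-size≤ ΓG))

  lk-vertex : ∀ {F y A} → Γ A → y ∈ e → y ∈ A → (∀ {x} → x ∈ F → x ∉ e → x ∈ A) →
              lk Γ ⁅ y ⁆ (F ─ e)
  lk-vertex {F} {y} {A} ΓA y∈e y∈A F⊆A =
      p─q∩r≡⊥ F (⁅x⁆⊆p y∈e)
    , closed _ A ΓA λ x∈ → [ off-edge , (λ { refl → y∈A }) ]′ (x∈p∪⁅y⁆⁻ x∈)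
    where
    off-edge : ∀ {x} → x ∈ F ─ e → x ∈ A
    off-edge x∈F─e = F⊆A (p─q⊆p F e x∈F─e) (x∈p─q⇒x∉q F e x∈F─e)

  -- The part of F off the edge lies in lk(a) ∩ lk(b), hence in the link of the edge by the
  -- link condition; a maximal link face joined with the edge contains F.
  extend-through-link : ∀ {F A B} → Γ A → Γ B → a ∈ A → b ∈ B →
                        (∀ {x} → x ∈ F → x ≢ b → x ∈ A) → (∀ {x} → x ∈ F → x ≢ a → x ∈ B) →
                        ∃[ H ] (Γ H × F ⊆ H × ∣ H ∣ ≡ sC)
  extend-through-link {F} {A} {B} ΓA ΓB a∈A b∈B F⊆A F⊆B =
    join-edge (extend L-pure (to (link (F ─ e)) (lk-vertex ΓA a∈edge a∈A F∖e⊆A ,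
                                                  lk-vertex ΓB b∈edge b∈B F∖e⊆B)))
    where
    F∖e⊆A : ∀ {x} → x ∈ F → x ∉ e → x ∈ A
    F∖e⊆A x∈F x∉e = F⊆A x∈F λ { refl → x∉e b∈edge }
    F∖e⊆B : ∀ {x} → x ∈ F → x ∉ e → x ∈ B
    F∖e⊆B x∈F x∉e = F⊆B x∈F λ { refl → x∉e a∈edge }
    join-edge : ∃[ M ] (lk Γ e M × F ─ e ⊆ M × ∣ M ∣ ≡ sL) → ∃[ H ] (Γ H × F ⊆ H × ∣ H ∣ ≡ sC)
    join-edge (M , lkM , F─e⊆M , ∣M∣) =
        M ∪ e , proj₂ lkM
      , (λ x∈F → [ p⊆p∪q e ∘ F─e⊆M , q⊆p∪q M e ]′ (x∈p∪q⁻ (F ─ e) e (p⊆p─q∪q F e x∈F)))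
      , trans (∣M∪e∣≡sL+2 lkM ∣M∣) (sym sC≡sL+2)

  Γ-extend : ∀ {F} → Γ F → ∃[ H ] (Γ H × F ⊆ H × ∣ H ∣ ≡ sC)
  Γ-extend {F} ΓF with a ∈? F | b ∈? F
  ... | yes a∈F | yes b∈F = extend-through-link ΓF ΓF a∈F b∈F (λ x∈F _ → x∈F) (λ x∈F _ → x∈F)
  ... | yes a∈F | no  b∉F with extend C-pure (inj₂ (F , ΓF , a∈F , refl))
  ...   | H , inj₁ (_ , ΓH) , imgF⊆H , _ =
    extend-through-link ΓF ΓH a∈F (imgF⊆H (b∈img F))
                        (λ x∈F _ → x∈F) (λ x∈F x≢a → imgF⊆H (∈-img⁺ x∈F x≢a))
  ...   | _ , inj₂ (G , ΓG , a∈G , refl) , imgF⊆imgG , ∣imgG∣ =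
    G , ΓG , ⊆-from-img a∈G b∉F (λ x∈F x≢a → imgF⊆imgG (∈-img⁺ x∈F x≢a)) , img-face ΓG a∈G ∣imgG∣
  Γ-extend {F} ΓF | no a∉F | b∈?F with extend C-pure (inj₁ (a∉F , ΓF))
  ... | H , inj₁ (_ , ΓH) , F⊆H , ∣H∣ = H , ΓH , F⊆H , ∣H∣
  ... | _ , inj₂ (G , ΓG , a∈G , refl) , F⊆imgG , ∣imgG∣ with b∈?F
  ...   | no  b∉F =
    G , ΓG , ⊆-from-img a∈G b∉F (λ x∈F _ → F⊆imgG x∈F) , img-face ΓG a∈G ∣imgG∣
  ...   | yes b∈F =
    extend-through-link ΓG ΓF a∈G b∈F (λ x∈F x≢b → ∈-img⁻ (F⊆imgG x∈F) x≢b) (λ x∈F _ → x∈F)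

  Γ-noConeVertex : NoConeVertex Γ sC
  Γ-noConeVertex v with C-noCone v
  ... | H , inj₁ (_ , ΓH) , v∉H , ∣H∣ = H , ΓH , v∉H , ∣H∣
  ... | _ , inj₂ (G , ΓG , a∈G , refl) , v∉imgG , ∣imgG∣ with v ≟ a
  ...   | no v≢a = G , ΓG , (λ v∈G → v∉imgG (∈-img⁺ v∈G v≢a)) , img-face ΓG a∈G ∣imgG∣
  ...   | yes refl = let H , ΓH , a∉H , _ , ∣H∣ = face-missing-edge in H , ΓH , a∉H , ∣H∣

  Γ-pure : PureOfSize Γ sC
  Γ-pure = record { size≤ = Γ-size≤ ; extend = Γ-extend }

sed⇒pureNoCone : ∀ {n} {Γ : Family n} → DownClosed Γ → StronglyEdgeDecomposable Γ →
                 ∃[ s ] (PureOfSize Γ s × NoConeVertex Γ s)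
sed⇒pureNoCone closed (sed-boundary ∂V) = simplexBoundary-pureNoCone ∂V
sed⇒pureNoCone closed (sed-empty ∅)     = 0 , emptyComplex-pureNoCone ∅
sed⇒pureNoCone closed (sed-step a b pure a<b _ link sedC sedL)
  with sC , C-pure , C-noCone ← sed⇒pureNoCone (Contraction.C-closed a b (<⇒≢ a<b) closed) sedC
  with sL , L-pure , L-noCone ← sed⇒pureNoCone (lk-closed closed) sedL =
    sC , Step.Γ-pure , Step.Γ-noConeVertex
  where
  module Step = EdgeStep (<⇒≢ a<b) closed pure link C-pure C-noCone L-pure L-noCone

-- Imported only here: ℤ's prefix +_ would make the ℕ sums of ∣_∣ above ambiguous to parse.
open import Data.Integer as ℤ using (ℤ; +_; +≤+; _-_)
open import Data.Integer.Properties using (drop‿+≤+; +-injective)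
open import Data.Integer.Tactic.RingSolver using (solve-∀)

module _ {n : ℕ} where

  +s-1+1≡+s : ∀ s → (+ s - + 1) ℤ.+ + 1 ≡ + s
  +s-1+1≡+s s = lemma (+ s)
    where
    lemma : ∀ (k : ℤ) → (k - + 1) ℤ.+ + 1 ≡ k
    lemma = solve-∀

  hasSize⇒hasDim : ∀ {Γ : Family n} {s} → HasSize Γ s → HasDim Γ (+ s - + 1)
  hasSize⇒hasDim {s = s} ((F , ΓF , ∣F∣≡s) , bound) =
      (F , ΓF , trans (cong +_ ∣F∣≡s) (sym (+s-1+1≡+s s)))
    , λ G ΓG → subst (+ ∣ G ∣ ℤ.≤_) (sym (+s-1+1≡+s s)) (+≤+ (bound ΓG))

  hasSize-unique : ∀ {Γ : Family n} {s d} → HasSize Γ s → HasDim Γ (+ d - + 1) → s ≡ d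
  hasSize-unique {s = s} {d} ((F , ΓF , ∣F∣≡s) , bound) ((G , ΓG , ∣G∣≡d) , boundℤ) =
    ≤-antisym s≤d d≤s
    where
    s≤d : s ≤ d
    s≤d = subst (_≤ d) ∣F∣≡s (drop‿+≤+ (subst (+ ∣ F ∣ ℤ.≤_) (+s-1+1≡+s d) (boundℤ F ΓF)))
    d≤s : d ≤ s
    d≤s = subst (_≤ s) (+-injective (trans ∣G∣≡d (+s-1+1≡+s d))) (bound ΓG)

  +m-1≡+[m+2]-3 : ∀ m → + m - + 1 ≡ + (m + 2) - + 3
  +m-1≡+[m+2]-3 m = lemma (+ m)
    where
    lemma : ∀ (k : ℤ) → k - + 1 ≡ (k ℤ.+ + 2) - + 3
    lemma = solve-∀

  edge-link-hasDim : ∀ {Γ : Family n} {s a b} → DownClosed Γ → PureOfSize Γ s → a ≢ b →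
                     Γ (edge a b) → HasDim (lk Γ (edge a b)) (+ s - + 3)
  edge-link-hasDim closed pure a≢b Γab with m , m+∣ab∣≡s , lk-hasSize ← link-hasSize closed pure Γab
    rewrite ∣edge∣≡2 a≢b | sym m+∣ab∣≡s =
      subst (HasDim _) (+m-1≡+[m+2]-3 m) (hasSize⇒hasDim lk-hasSize)

lemma2p4 : (n : ℕ) (Γ : Subset n → Set) (d : ℕ) →
    IsSimplicialComplexOn Γ → HasDim Γ (+ d - + 1) → StronglyEdgeDecomposable Γ →
    (i j : Fin n) → i < j → Γ (edge i j) →
    HasDim (C Γ i j) (+ d - + 1) × HasDim (lk Γ (edge i j)) (+ d - + 3)
lemma2p4 n Γ d (_ , closed) dimΓ sed i j i<j Γij
  with s , pure , noCone ← sed⇒pureNoCone closed sed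
  with refl ← hasSize-unique {d = d} (pure⇒hasSize pure Γij) dimΓ =
    hasSize⇒hasDim (Contraction.contraction-hasSize i j (<⇒≢ i<j) pure noCone)
  , edge-link-hasDim closed pure (<⇒≢ i<j) Γij
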